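{- For all $n\in\mathbb{N}$ with $n\ge1$ and all $X\in\mathrm{IS}$: if $X\in\mathcal{C}_n$, then $X$ computes $\mathrm{tstnz}_n$.
   Context: Basic instructions: $\mathtt{in}{:}i.\mathtt{get}$ ($i\ge1$), $\mathtt{out}.\mathtt{set}{:}b$ ($b\in\{0,1\}$), $\mathtt{aux}{:}i.\mathtt{get}$ ($i\ge1$), $\mathtt{aux}{:}i.\mathtt{set}{:}b$ ($i\ge1$, $b\in\{0,1\}$). The part before the dot names a Boolean register ($\mathtt{in}{:}i$ input, $\mathtt{out}$ output, $\mathtt{aux}{:}i$ auxiliary); $\mathtt{get}$ changes nothing and replies the content, $\mathtt{set}{:}b$ makes the content $b$ and replies $b$. Primitive instructions: for each basic instruction $a$, plain $a$, positive test $+a$, negative test $-a$; forward jumps $\#l$ ($l\in\mathbb{N}$); termination $!$. $\mathrm{IS}$ is the set of finite sequences $X=u_1;\dots;u_k$ of primitive instructions, $\mathrm{len}(X)=k$. Execution starts at $u_1$: plain $a$ executes $a$ and proceeds with the next instruction; $+a$ executes $a$ and proceeds with the next instruction if the reply is $1$, otherwise skips the next one and proceeds with the one after it; $-a$ likewise with replies reversed; $\#l$ proceeds with the $l$-th next instruction; $!$ terminates. If $l=0$ or there is no instruction to proceed with, execution never terminates. For $f:\{0,1\}^n\to\{0,1\}$, $X$ computes $f$ if there is $k$ such that for all $b_1,\dots,b_n$, executing $X$ with $\mathtt{in}{:}i$ initially $b_i$, $\mathtt{out}$ and $\mathtt{aux}{:}1,\dots,\mathtt{aux}{:}k$ initially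 $0$ (other registers arbitrary) terminates with final content of $\mathtt{out}$ equal to $f(b_1,\dots,b_n)$. $\mathrm{tstnz}_n(b_1,\dots,b_n)=1$ iff some $b_i=1$. Notation: $;_{i=p}^{q}P_i$ denotes the concatenation $P_p;\dots;P_q$, which is empty if $p>q$. Write $r_i$ for $\mathtt{in}{:}i.\mathtt{get}$. The set $\mathcal{C}_n\subseteq\mathrm{IS}$ is defined as follows. For even $n$: $X\in\mathcal{C}_n$ iff $X={;}_{i=1}^{n/2}\big(-r_{\rho(2i-1)};+r_{\rho(2i)};\varphi(i)\big);!$ for some bijection $\rho$ of $\{1,\dots,n\}$ and some function $\varphi$ from $\{1,\dots,n/2\}$ to primitive instructions with $\varphi(j)\in\{\#3k: k\ge1, k\le n/2-j\}\cup\{\mathtt{out}.\mathtt{set}{:}1,+\mathtt{out}.\mathtt{set}{:}1,-\mathtt{out}.\mathtt{set}{:}1\}$ for all $j$, and $\varphi(n/2)\in\{\mathtt{out}.\mathtt{set}{:}1,+\mathtt{out}.\mathtt{set}{:}1\}$. For odd $n$: $X\in\mathcal{C}_n$ iff there exist $m\in\mathbb{N}$ with $m\le(n-1)/2$, a bijection $\rho$ of $\{1,\dots,n\}$ and a function $\varphi$ from $\{1,\dots,(n+1)/2\}$ to primitive instructions such that $X={;}_{i=1}^{m}\big(-r_{\rho(2i-1)};+r_{\rho(2i)};\varphi(i)\big);+r_{\rho(2m+1)};\varphi(m+1);{;}_{i=m+1}^{(n-1)/2}\big(-r_{\rho(2i)};+r_{\rho(2i+1)};\varphi(i+1)\big);!$,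 where for all $j$, $\varphi(j)\in\{\#(3k-1): k\ge1, k\le(n+1)/2-j, j\le m<j+k\}\cup\{\#3k: k\ge1, k\le(n+1)/2-j, \text{not } (j\le m<j+k)\}\cup\{\mathtt{out}.\mathtt{set}{:}1,+\mathtt{out}.\mathtt{set}{:}1,-\mathtt{out}.\mathtt{set}{:}1\}$, and $\varphi((n+1)/2)\in\{\mathtt{out}.\mathtt{set}{:}1,+\mathtt{out}.\mathtt{set}{:}1\}$. -}

module Defs where

open import Data.Nat using (ℕ; zero; suc; _+_; _*_; _∸_; _≤_; _<_; ⌊_/2⌋)
open import Data.Nat.DivMod using (_%_)
open import Data.Bool using (Bool; true; false; _∨_)
open import Data.List using (List; []; _∷_; _++_; drop; concatMap; map; upTo)
open import Data.Vec using (Vec; lookup)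
import Data.Vec as V
open import Data.Fin using (Fin; toℕ)
open import Data.Product using (Σ; ∃; _×_; _,_)
open import Data.Sum using (_⊎_)
open import Relation.Binary.PropositionalEquality using (_≡_)
open import Relation.Nullary using (¬_)

-- Registers and basic instructions.
-- Register indices are natural numbers; the paper's registers are
-- in:i and aux:i for i ≥ 1 (index 0 is an unused extra register).

data Basic : Set where
  inGet  : ℕ → Basic
  outSet : Bool → Basic
  auxGet : ℕ → Basic
  auxSet : ℕ → Bool → Basic

data Prim : Set where
  plain : Basic → Prim
  pos   : Basic → Prim
  neg   : Basic → Prim
  jump  : ℕ → Prim
  halt  : Prim

IS : Set
IS = List Prim

record State : Set where
  constructor mkState
  field
    inp : ℕ → Bool
    out : Bool
    aux : ℕ → Bool
open State public

update : (ℕ → Bool) → ℕ → Bool → ℕ → Bool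
update f i b j with Data.Nat._≟_ i j
... | Relation.Nullary.yes _ = b
... | Relation.Nullary.no  _ = f j

effect : Basic → State → State
effect (inGet i)    s = s
effect (outSet b)   s = mkState (inp s) b (aux s)
effect (auxGet i)   s = s
effect (auxSet i b) s = mkState (inp s) (out s) (update (aux s) i b)

reply : Basic → State → Bool
reply (inGet i)    s = inp s i
reply (outSet b)   s = b
reply (auxGet i)   s = aux s i
reply (auxSet i b) s = b

-- Big-step execution: Runs xs s s' means that execution of the
-- remaining instruction sequence xs (execution positioned at its first
-- instruction) from state s terminates (by !) in state s'.
-- There is no rule for [] (no instruction to proceed with) nor for #0,
-- which are exactly the non-terminating cases.
data Runs : IS → State → State → Set where
  run-halt  : ∀ {xs s} → Runs (halt ∷ xs) s s
  run-plain : ∀ {a xs s s'} → Runs xs (effect a s) s' → Runs (plain a ∷ xs) s s'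
  run-pos1  : ∀ {a xs s s'} → reply a s ≡ true →
              Runs xs (effect a s) s' → Runs (pos a ∷ xs) s s'
  run-pos0  : ∀ {a xs s s'} → reply a s ≡ false →
              Runs (drop 1 xs) (effect a s) s' → Runs (pos a ∷ xs) s s'
  run-neg1  : ∀ {a xs s s'} → reply a s ≡ false →
              Runs xs (effect a s) s' → Runs (neg a ∷ xs) s s'
  run-neg0  : ∀ {a xs s s'} → reply a s ≡ true →
              Runs (drop 1 xs) (effect a s) s' → Runs (neg a ∷ xs) s s'
  run-jump  : ∀ {m xs s s'} → Runs (drop m xs) s s' → Runs (jump (suc m) ∷ xs) s s'

Computes : (n : ℕ) → (Vec Bool n → Bool) → IS → Set
Computes n f X =
  ∃ λ k → ∀ (b : Vec Bool n) (s : State) →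
    (∀ (i : Fin n) → inp s (suc (toℕ i)) ≡ lookup b i) →
    out s ≡ false →
    (∀ i → 1 ≤ i → i ≤ k → aux s i ≡ false) →
    ∃ λ s' → Runs X s s' × out s' ≡ f b

tstnz : ∀ {n} → Vec Bool n → Bool
tstnz V.[] = false
tstnz (x V.∷ xs) = x ∨ tstnz xs

-- ;_{i=p}^{q} P_i  (empty if p > q)
seqᵢ : ℕ → ℕ → (ℕ → IS) → IS
seqᵢ p q P = concatMap P (map (p +_) (upTo (suc q ∸ p)))

BijectionOn : ℕ → (ℕ → ℕ) → Set
BijectionOn n ρ =
  (∀ j → 1 ≤ j → j ≤ n → 1 ≤ ρ j × ρ j ≤ n) ×
  (∀ i j → 1 ≤ i → i ≤ n → 1 ≤ j → j ≤ n → ρ i ≡ ρ j → i ≡ j) ×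
  (∀ j → 1 ≤ j → j ≤ n → ∃ λ i → 1 ≤ i × i ≤ n × ρ i ≡ j)

r : ℕ → Basic
r i = inGet i

setOut1 : Prim → Set
setOut1 u = u ≡ plain (outSet true) ⊎ u ≡ pos (outSet true) ⊎ u ≡ neg (outSet true)

lastOK : Prim → Set
lastOK u = u ≡ plain (outSet true) ⊎ u ≡ pos (outSet true)

CEven : (h : ℕ) → IS → Set
CEven h X =
  Σ (ℕ → ℕ) λ ρ → Σ (ℕ → Prim) λ φ →
    BijectionOn (h + h) ρ ×
    (∀ j → 1 ≤ j → j ≤ h →
       (∃ λ k → 1 ≤ k × k ≤ h ∸ j × φ j ≡ jump (3 * k)) ⊎ setOut1 (φ j)) ×
    lastOK (φ h) ×
    X ≡ seqᵢ 1 h (λ i → neg (r (ρ (2 * i ∸ 1))) ∷ pos (r (ρ (2 * i))) ∷ φ i ∷ [])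
          ++ halt ∷ []

-- odd n = 2h + 1   (so (n-1)/2 = h and (n+1)/2 = h + 1)
COdd : (h : ℕ) → IS → Set
COdd h X =
  Σ ℕ λ m → Σ (ℕ → ℕ) λ ρ → Σ (ℕ → Prim) λ φ →
    m ≤ h ×
    BijectionOn (suc (h + h)) ρ ×
    (∀ j → 1 ≤ j → j ≤ suc h →
       (∃ λ k → 1 ≤ k × k ≤ suc h ∸ j × (j ≤ m × m < j + k) ×
                φ j ≡ jump (3 * k ∸ 1)) ⊎
       (∃ λ k → 1 ≤ k × k ≤ suc h ∸ j × ¬ (j ≤ m × m < j + k) ×
                φ j ≡ jump (3 * k)) ⊎
       setOut1 (φ j)) ×
    lastOK (φ (suc h)) ×
    X ≡ seqᵢ 1 m (λ i → neg (r (ρ (2 * i ∸ 1))) ∷ pos (r (ρ (2 * i))) ∷ φ i ∷ [])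
          ++ (pos (r (ρ (2 * m + 1))) ∷ φ (m + 1) ∷ [])
          ++ seqᵢ (m + 1) h (λ i → neg (r (ρ (2 * i))) ∷ pos (r (ρ (2 * i + 1))) ∷ φ (i + 1) ∷ [])
          ++ halt ∷ []

C : ℕ → IS → Set
C n X = (n % 2 ≡ 0 × CEven ⌊ n /2⌋ X) ⊎ (n % 2 ≡ 1 × COdd ⌊ n /2⌋ X)

-- A member of C_n is a sequence of blocks followed by !: each block tests one
-- or two inputs (−r_a;+r_b or +r_c) and then performs an action u, which is
-- reached exactly when one of the block's inputs is 1; otherwise control
-- falls through to the next block.  Every admissible action either sets out
-- to 1 or jumps (#3k, or #(3k−1) across the single one-test block) exactly
-- onto the action of a later block, so once out = 1 every path keeps it and
-- halts.  Hence the program halts with out = 1 iff one of the inputs it reads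
-- is 1, and it reads in:ρ(1), …, in:ρ(n) for a bijection ρ.
module Submission where

open import Defs
open import Data.Nat using (ℕ; zero; suc; _+_; _*_; _∸_; _≤_; _<_; z≤n; s≤s; ⌊_/2⌋)
open import Data.Nat.DivMod using (_%_)
open import Data.Nat.Properties
open import Data.Nat.Tactic.RingSolver using (solve-∀)
open import Data.Bool using (Bool; true; false; _∨_)
open import Data.Bool.ListAction using (any)
open import Data.Bool.Properties using (T-≡; ⇔→≡; ∨-assoc)
open import Data.List using (List; []; _∷_; _++_; drop; concatMap; map; upTo; applyUpTo; length)
open import Data.List.Properties
  using (++-assoc; ++-identityʳ; map-++; length-map; concatMap-map; concatMap-++; map-applyUpTo)
open import Data.List.Membership.Propositional using (_∈_; find; lose)
open import Data.List.Membership.Propositional.Properties using (∈-map⁺; ∈-map⁻)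
open import Data.List.Relation.Unary.All using (All; universal)
open import Data.List.Relation.Unary.All.Properties using () renaming (map⁺ to All-map⁺)
open import Data.List.Relation.Unary.Any using (here; there)
open import Data.List.Relation.Unary.Any.Properties using (any⁺; any⁻)
open import Data.Vec using (Vec; lookup)
import Data.Vec as Vec
open import Data.Fin using (toℕ)
import Data.Fin as Fin
open import Data.Product using (∃; _×_; _,_)
open import Data.Sum using (_⊎_; inj₁; inj₂)
open import Data.Unit using (⊤; tt)
open import Data.Empty using (⊥)
open import Function using (_∘_; _⇔_; mk⇔; Equivalence)
open import Relation.Nullary using (¬_; contradiction)
open import Relation.Binary.PropositionalEquality

interval : ℕ → ℕ → List ℕ
interval j zero    = []
interval j (suc n) = j ∷ interval (suc j) n

length-interval : ∀ j n → length (interval j n) ≡ n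
length-interval j zero    = refl
length-interval j (suc n) = cong suc (length-interval (suc j) n)

interval-++ : ∀ j m n → interval j (m + n) ≡ interval j m ++ interval (j + m) n
interval-++ j zero    n = cong (λ i → interval i n) (sym (+-identityʳ j))
interval-++ j (suc m) n =
  cong (j ∷_) (trans (interval-++ (suc j) m n) (cong (λ i → interval (suc j) m ++ interval i n) (sym (+-suc j m))))

applyUpTo-interval : ∀ {f : ℕ → ℕ} j n → (∀ i → f i ≡ j + i) → applyUpTo f n ≡ interval j n
applyUpTo-interval j zero    _  = refl
applyUpTo-interval j (suc n) f≗ =
  cong₂ _∷_ (trans (f≗ 0) (+-identityʳ j)) (applyUpTo-interval (suc j) n (λ i → trans (f≗ (suc i)) (+-suc j i)))

map-+-upTo : ∀ j n → map (j +_) (upTo n) ≡ interval j n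
map-+-upTo j n = trans (map-applyUpTo (λ i → i) (j +_) n) (applyUpTo-interval j n (λ _ → refl))

∈-interval⁻ : ∀ {x j n} → x ∈ interval j n → j ≤ x × x < j + n
∈-interval⁻ {j = j} {suc n} (here refl) = ≤-refl , m<m+n j (s≤s z≤n)
∈-interval⁻ {j = j} {suc n} (there x∈) =
  let j<x , x<1+j+n = ∈-interval⁻ x∈ in <⇒≤ j<x , <-≤-trans x<1+j+n (≤-reflexive (sym (+-suc j n)))

∈-interval⁺ : ∀ {x j n} → j ≤ x → x < j + n → x ∈ interval j n
∈-interval⁺ {j = j} {zero} j≤x x<j+0 = contradiction (<-≤-trans x<j+0 (≤-reflexive (+-identityʳ j))) (≤⇒≯ j≤x)
∈-interval⁺ {x} {j} {suc n} j≤x x<j+1+n with m≤n⇒m<n∨m≡n j≤x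
... | inj₁ j<x  = there (∈-interval⁺ j<x (subst (x <_) (+-suc j n) x<j+1+n))
... | inj₂ refl = here refl

any-++ : ∀ {A : Set} (p : A → Bool) xs ys → any p (xs ++ ys) ≡ any p xs ∨ any p ys
any-++ p []       ys = refl
any-++ p (x ∷ xs) ys = trans (cong (p x ∨_) (any-++ p xs ys)) (sym (∨-assoc (p x) _ _))

any-≡-true : ∀ {A : Set} {p : A → Bool} {xs} → any p xs ≡ true ⇔ (∃ λ x → x ∈ xs × p x ≡ true)
any-≡-true {p = p} {xs} = mk⇔
  (λ e → let x , x∈ , px = find (any⁻ p xs (Equivalence.from T-≡ e)) in x , x∈ , Equivalence.to T-≡ px)
  (λ (x , x∈ , px) → Equivalence.to T-≡ (any⁺ p (lose x∈ (Equivalence.from T-≡ px))))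

any-interval≡tstnz : ∀ {p : ℕ → Bool} {n} j (b : Vec Bool n) →
                     (∀ i → p (j + toℕ i) ≡ lookup b i) → any p (interval j n) ≡ tstnz b
any-interval≡tstnz j Vec.[]       _   = refl
any-interval≡tstnz {p} j (x Vec.∷ b) p≡b =
  cong₂ _∨_ (trans (cong p (sym (+-identityʳ j))) (p≡b Fin.zero))
            (any-interval≡tstnz (suc j) b (λ i → trans (cong p (sym (+-suc j (toℕ i)))) (p≡b (Fin.suc i))))

any-permute : ∀ {n ρ} (p : ℕ → Bool) → BijectionOn n ρ → any p (map ρ (interval 1 n)) ≡ any p (interval 1 n)
any-permute {n} {ρ} p (into , _ , onto) = ⇔→≡ {z = true} (mk⇔ to from)
  where
  to : any p (map ρ (interval 1 n)) ≡ true → any p (interval 1 n) ≡ true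
  to e with Equivalence.to any-≡-true e
  ... | y , y∈ , py with ∈-map⁻ ρ y∈
  ...   | i , i∈ , refl with ∈-interval⁻ i∈
  ...     | 1≤i , i<1+n with into i 1≤i (≤-pred i<1+n)
  ...       | 1≤ρi , ρi≤n = Equivalence.from any-≡-true (ρ i , ∈-interval⁺ 1≤ρi (s≤s ρi≤n) , py)
  from : any p (interval 1 n) ≡ true → any p (map ρ (interval 1 n)) ≡ true
  from e with Equivalence.to any-≡-true e
  ... | x , x∈ , px with ∈-interval⁻ x∈
  ...   | 1≤x , x<1+n with onto x 1≤x (≤-pred x<1+n)
  ...     | i , 1≤i , i≤n , refl = Equivalence.from any-≡-true (ρ i , ∈-map⁺ ρ (∈-interval⁺ 1≤i (s≤s i≤n)) , px)

-- Block programs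

data Block : Set where
  pair   : ℕ → ℕ → Prim → Block
  single : ℕ → Prim → Block

action : Block → Prim
action (pair _ _ u) = u
action (single _ u) = u

inputs : Block → List ℕ
inputs (pair a b _) = a ∷ b ∷ []
inputs (single c _) = c ∷ []

code : Block → IS
code (pair a b u) = neg (r a) ∷ pos (r b) ∷ u ∷ []
code (single c u) = pos (r c) ∷ u ∷ []

program : List Block → IS
program bs = concatMap code bs ++ halt ∷ []

reads : List Block → List ℕ
reads = concatMap inputs

-- Instruction number d (counting from 0) of program bs is the action of a block.
data ActionAt : ℕ → List Block → Set where
  here-pair    : ∀ {a b u bs} → ActionAt 2 (pair a b u ∷ bs)
  here-single  : ∀ {c u bs} → ActionAt 1 (single c u ∷ bs)
  there-pair   : ∀ {a b u bs d} → ActionAt d bs → ActionAt (3 + d) (pair a b u ∷ bs)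
  there-single : ∀ {c u bs d} → ActionAt d bs → ActionAt (2 + d) (single c u ∷ bs)

-- The admissible actions of a block followed by the blocks bs; −out.set:1
-- skips the next instruction, which therefore must not be the final !.
data SafeAction : Prim → List Block → Set where
  set-out  : ∀ {bs} → SafeAction (plain (outSet true)) bs
  set-out⁺ : ∀ {bs} → SafeAction (pos (outSet true)) bs
  set-out⁻ : ∀ {b bs} → SafeAction (neg (outSet true)) (b ∷ bs)
  jump-to  : ∀ {d bs} → ActionAt d bs → SafeAction (jump (suc d)) bs

WellFormed : List Block → Set
WellFormed []       = ⊤
WellFormed (b ∷ bs) = SafeAction (action b) bs × WellFormed bs

Halts : IS → State → (State → Set) → Set
Halts X s Q = ∃ λ s' → Runs X s s' × Q s'

OutIs : Bool → State → Set
OutIs b s = out s ≡ b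

prepend : ∀ {X Y s t Q} → (∀ {s'} → Runs Y t s' → Runs X s s') → Halts Y t Q → Halts X s Q
prepend step (s' , run , q) = s' , step run , q

Halts-mono : ∀ {X s P Q} → (∀ {s'} → P s' → Q s') → Halts X s P → Halts X s Q
Halts-mono f (s' , run , p) = s' , run , f p

block-halts : ∀ {Q} b bs s →
              (any (inp s) (inputs b) ≡ true → Halts (action b ∷ program bs) s Q) →
              (any (inp s) (inputs b) ≡ false → Halts (program bs) s Q) →
              Halts (program (b ∷ bs)) s Q
block-halts (pair a c u) bs s hit miss with inp s a in a≡
... | true  = prepend (run-neg0 a≡) (hit refl)
... | false with inp s c in c≡
...   | true  = prepend (λ run → run-neg1 a≡ (run-pos1 c≡ run)) (hit refl)
...   | false = prepend (λ run → run-neg1 a≡ (run-pos0 c≡ run)) (miss refl)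
block-halts (single c u) bs s hit miss with inp s c in c≡
... | true  = prepend (run-pos1 c≡) (hit refl)
... | false = prepend (run-pos0 c≡) (miss refl)

program-halts-true  : ∀ {bs s} → WellFormed bs → out s ≡ true → Halts (program bs) s (OutIs true)
action-halts-true   : ∀ {u bs s} → SafeAction u bs → WellFormed bs → Halts (u ∷ program bs) s (OutIs true)
actionAt-halts-true : ∀ {d bs s} → ActionAt d bs → WellFormed bs → Halts (drop d (program bs)) s (OutIs true)

program-halts-true {[]}     {s} _         out≡ = s , run-halt , out≡
program-halts-true {b ∷ bs} {s} (safe , wf) out≡ =
  block-halts b bs s (λ _ → action-halts-true safe wf) (λ _ → program-halts-true wf out≡)

action-halts-true set-out  wf = prepend run-plain (program-halts-true wf refl)
action-halts-true set-out⁺ wf = prepend (run-pos1 refl) (program-halts-true wf refl)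
-- Skipping −r_a leaves the block +r_c;v.
action-halts-true {bs = pair a c v ∷ bs} set-out⁻ (safe , wf) =
  prepend (run-neg0 refl)
    (block-halts (single c v) bs _ (λ _ → action-halts-true safe wf) (λ _ → program-halts-true wf refl))
action-halts-true {bs = single c v ∷ bs} set-out⁻ (safe , wf) = prepend (run-neg0 refl) (action-halts-true safe wf)
action-halts-true (jump-to at) wf = prepend run-jump (actionAt-halts-true at wf)

actionAt-halts-true here-pair        (safe , wf) = action-halts-true safe wf
actionAt-halts-true here-single      (safe , wf) = action-halts-true safe wf
actionAt-halts-true (there-pair at)   (_ , wf)   = actionAt-halts-true at wf
actionAt-halts-true (there-single at) (_ , wf)   = actionAt-halts-true at wf

program-computes-any : ∀ {bs s} → WellFormed bs → out s ≡ false →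
                       Halts (program bs) s (OutIs (any (inp s) (reads bs)))
program-computes-any {[]}     {s} _           out≡ = s , run-halt , out≡
program-computes-any {b ∷ bs} {s} (safe , wf) out≡ = block-halts b bs s
  (λ hit  → Halts-mono (λ q → trans q (sym (trans any≡ (cong (_∨ _) hit))))  (action-halts-true safe wf))
  (λ miss → Halts-mono (λ q → trans q (sym (trans any≡ (cong (_∨ _) miss)))) (program-computes-any wf out≡))
  where
  any≡ : any (inp s) (reads (b ∷ bs)) ≡ any (inp s) (inputs b) ∨ any (inp s) (reads bs)
  any≡ = any-++ (inp s) (inputs b) (reads bs)

blockProgram-computes : ∀ {n ρ bs} → BijectionOn n ρ → WellFormed bs → reads bs ≡ map ρ (interval 1 n) →
                        Computes n tstnz (program bs)
blockProgram-computes {n} {ρ} {bs} bij wf reads≡ = 0 , λ b s inputs≡ out≡false _ →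
  Halts-mono (λ {s'} out≡ → begin
      out s'                             ≡⟨ out≡ ⟩
      any (inp s) (reads bs)             ≡⟨ cong (any (inp s)) reads≡ ⟩
      any (inp s) (map ρ (interval 1 n)) ≡⟨ any-permute (inp s) bij ⟩
      any (inp s) (interval 1 n)         ≡⟨ any-interval≡tstnz 1 b inputs≡ ⟩
      tstnz b                            ∎)
    (program-computes-any wf out≡false)
  where open ≡-Reasoning

IsPair : Block → Set
IsPair (pair _ _ _) = ⊤
IsPair (single _ _) = ⊥

retarget : ∀ {d e bs} → d ≡ e → ActionAt d bs → ActionAt e bs
retarget refl at = at

actionAt-++ʳ : ∀ {d xs} ys → ActionAt d xs → ActionAt d (xs ++ ys)
actionAt-++ʳ ys here-pair         = here-pair
actionAt-++ʳ ys here-single       = here-single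
actionAt-++ʳ ys (there-pair at)   = there-pair (actionAt-++ʳ ys at)
actionAt-++ʳ ys (there-single at) = there-single (actionAt-++ʳ ys at)

actionAt-++ˡ : ∀ {d ps bs} → All IsPair ps → ActionAt d bs → ActionAt (3 * length ps + d) (ps ++ bs)
actionAt-++ˡ {ps = []}             _                  at = at
actionAt-++ˡ {d} {pair _ _ _ ∷ ps} (_ All.∷ pairs) at =
  retarget (sym (cong (_+ d) (*-suc 3 (length ps)))) (there-pair (actionAt-++ˡ pairs at))
actionAt-++ˡ {ps = single _ _ ∷ _} (() All.∷ _)    _

actionAt-pair : ∀ {ps k} → All IsPair ps → k < length ps → ActionAt (2 + 3 * k) ps
actionAt-pair {pair _ _ _ ∷ _} {zero}  _               _        = here-pair
actionAt-pair {pair _ _ _ ∷ _} {suc k} (_ All.∷ pairs) (s≤s k<) =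
  retarget (cong (2 +_) (sym (*-suc 3 k))) (there-pair (actionAt-pair pairs k<))
actionAt-pair {single _ _ ∷ _} (() All.∷ _) _

actionAt-single : ∀ {c v qs k} → All IsPair qs → k ≤ length qs → ActionAt (1 + 3 * k) (single c v ∷ qs)
actionAt-single {k = zero}  _     _   = here-single
actionAt-single {k = suc k} pairs k< =
  retarget (cong suc (sym (*-suc 3 k))) (there-single (actionAt-pair pairs k<))

SafeAction-++ʳ : ∀ {u xs} ys → SafeAction u xs → SafeAction u (xs ++ ys)
SafeAction-++ʳ ys set-out      = set-out
SafeAction-++ʳ ys set-out⁺     = set-out⁺
SafeAction-++ʳ ys set-out⁻     = set-out⁻
SafeAction-++ʳ ys (jump-to at) = jump-to (actionAt-++ʳ ys at)

rejump : ∀ {l l′ bs} → l ≡ l′ → SafeAction (jump l) bs → SafeAction (jump l′) bs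
rejump refl safe = safe

setOut1-safe : ∀ {u b bs} xs → setOut1 u → SafeAction u (xs ++ b ∷ bs)
setOut1-safe _       (inj₁ refl)        = set-out
setOut1-safe _       (inj₂ (inj₁ refl)) = set-out⁺
setOut1-safe []      (inj₂ (inj₂ refl)) = set-out⁻
setOut1-safe (_ ∷ _) (inj₂ (inj₂ refl)) = set-out⁻

lastOK-safe : ∀ {u bs} → lastOK u → SafeAction u bs
lastOK-safe (inj₁ refl) = set-out
lastOK-safe (inj₂ refl) = set-out⁺

jump3-safe : ∀ {ps k} → All IsPair ps → 1 ≤ k → k ≤ length ps → SafeAction (jump (3 * k)) ps
jump3-safe {k = suc k} pairs _ k< =
  rejump (sym (*-suc 3 k)) (jump-to (actionAt-pair pairs k<))

jump-across-safe : ∀ {ps qs k c v} → All IsPair ps → All IsPair qs →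
                   length ps < k → k ≤ length ps + suc (length qs) →
                   SafeAction (jump (3 * k ∸ 1)) (ps ++ single c v ∷ qs)
jump-across-safe {ps} {qs} pairs pairs′ l<k k≤ with m≤n⇒∃[o]m+o≡n l<k
... | j , refl =
  rejump (sym (cong (_∸ 1) (across (length ps) j)))
    (jump-to (actionAt-++ˡ pairs (actionAt-single pairs′ j≤)))
  where
  across : ∀ l j → 3 * (suc l + j) ≡ suc (suc (3 * l + (1 + 3 * j)))
  across = solve-∀
  j≤ : j ≤ length qs
  j≤ = +-cancelˡ-≤ (length ps) j (length qs) (≤-pred (subst (suc (length ps + j) ≤_) (+-suc (length ps) _) k≤))

-- The condition on φ j in CEven, for r = h ∸ j later blocks.
PairRule : ℕ → Prim → Set
PairRule r u = (∃ λ k → 1 ≤ k × k ≤ r × u ≡ jump (3 * k)) ⊎ setOut1 u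

pairRule-safe : ∀ {p ps u} → All IsPair (p ∷ ps) → PairRule (length (p ∷ ps)) u → SafeAction u (p ∷ ps)
pairRule-safe pairs (inj₁ (k , 1≤k , k≤ , refl)) = jump3-safe pairs 1≤k k≤
pairRule-safe _     (inj₂ s)                     = setOut1-safe [] s

wellFormed-map-++ : ∀ (B : ℕ → Block) {rest} → WellFormed rest → ∀ j n →
                    (∀ i n′ → j ≤ i → i + suc n′ ≡ j + n →
                      SafeAction (action (B i)) (map B (interval (suc i) n′) ++ rest)) →
                    WellFormed (map B (interval j n) ++ rest)
wellFormed-map-++ B wf j zero    _    = wf
wellFormed-map-++ B wf j (suc n) safe =
  safe j n ≤-refl refl ,
  wellFormed-map-++ B wf (suc j) n (λ i n′ j<i eq → safe i n′ (<⇒≤ j<i) (trans eq (sym (+-suc j n))))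

length-blocks : ∀ (B : ℕ → Block) j n → length (map B (interval j n)) ≡ n
length-blocks B j n = trans (length-map B (interval j n)) (length-interval j n)

All-pairs : ∀ (B : ℕ → Block) → (∀ i → IsPair (B i)) → ∀ xs → All IsPair (map B xs)
All-pairs B pairs xs = All-map⁺ (universal pairs xs)

m+[1+n]≡1+o⇒m≤o : ∀ {m n o} → m + suc n ≡ suc o → m ≤ o
m+[1+n]≡1+o⇒m≤o {m} eq = ≤-pred (<-≤-trans (m<m+n m (s≤s z≤n)) (≤-reflexive eq))

m+[1+n]≡1+o⇒o∸m≡n : ∀ {m n o} → m + suc n ≡ suc o → o ∸ m ≡ n
m+[1+n]≡1+o⇒o∸m≡n {m} {n} eq =
  trans (cong (_∸ m) (sym (suc-injective (trans (sym (+-suc m n)) eq)))) (m+n∸m≡n m n)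

[1+m+n+o]∸m≡n+[1+o] : ∀ m n o → suc (m + n + o) ∸ m ≡ n + suc o
[1+m+n+o]∸m≡n+[1+o] m n o = trans (cong (_∸ m) (rearrange m n o)) (m+n∸m≡n m (n + suc o))
  where
  rearrange : ∀ m n o → suc (m + n + o) ≡ m + (n + suc o)
  rearrange = solve-∀

pairRun-safe : ∀ (B : ℕ → Block) → (∀ i → IsPair (B i)) → ∀ {L i n} → i + suc n ≡ suc L →
               PairRule (L ∸ i) (action (B i)) → lastOK (action (B L)) →
               SafeAction (action (B i)) (map B (interval (suc i) n) ++ [])
pairRun-safe B pairs {L} {i} {zero} eq _ last =
  lastOK-safe (subst (λ j → lastOK (action (B j))) (sym i≡L) last)
  where
  i≡L : i ≡ L
  i≡L = trans (sym (+-identityʳ i)) (suc-injective (trans (sym (+-suc i 0)) eq))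
pairRun-safe B pairs {L} {i} {suc n} eq rule _ =
  SafeAction-++ʳ [] (pairRule-safe (All-pairs B pairs _) (subst (λ r → PairRule r (action (B i))) r≡ rule))
  where
  r≡ : L ∸ i ≡ suc (length (map B (interval (suc (suc i)) n)))
  r≡ = trans (m+[1+n]≡1+o⇒o∸m≡n eq) (cong suc (sym (length-blocks B _ n)))

seqᵢ-blocks : ∀ (B : ℕ → Block) j L → seqᵢ j L (code ∘ B) ≡ concatMap code (map B (interval j (suc L ∸ j)))
seqᵢ-blocks B j L =
  trans (cong (concatMap (code ∘ B)) (map-+-upTo j (suc L ∸ j))) (sym (concatMap-map code B (interval j (suc L ∸ j))))

reads-pairs : ∀ {ρ : ℕ → ℕ} (B : ℕ → Block) (g : ℕ → ℕ) j n →
              (∀ i → j ≤ i → inputs (B i) ≡ ρ (g i) ∷ ρ (suc (g i)) ∷ []) →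
              (∀ i → j ≤ i → g (suc i) ≡ suc (suc (g i))) →
              reads (map B (interval j n)) ≡ map ρ (interval (g j) (n + n))
reads-pairs B g j zero    _   _    = refl
reads-pairs {ρ} B g j (suc n) ins step = begin
  inputs (B j) ++ reads (map B (interval (suc j) n))
    ≡⟨ cong₂ _++_ (ins j ≤-refl)
         (reads-pairs B g (suc j) n (λ i j<i → ins i (<⇒≤ j<i)) (λ i j<i → step i (<⇒≤ j<i))) ⟩
  ρ (g j) ∷ ρ (suc (g j)) ∷ map ρ (interval (g (suc j)) (n + n))
    ≡⟨ cong (λ i → ρ (g j) ∷ ρ (suc (g j)) ∷ map ρ (interval i (n + n))) (step j ≤-refl) ⟩
  map ρ (interval (g j) (suc (suc (n + n))))
    ≡⟨ cong (λ k → map ρ (interval (g j) (suc k))) (sym (+-suc n n)) ⟩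
  map ρ (interval (g j) (suc n + suc n)) ∎
  where open ≡-Reasoning

-- The members of C_n as block programs

pairBlock : (ℕ → ℕ) → (ℕ → Prim) → ℕ → Block
pairBlock ρ φ i = pair (ρ (2 * i ∸ 1)) (ρ (2 * i)) (φ i)

shiftedPairBlock : (ℕ → ℕ) → (ℕ → Prim) → ℕ → Block
shiftedPairBlock ρ φ i = pair (ρ (2 * i)) (ρ (2 * i + 1)) (φ (i + 1))

-- The hypotheses of reads-pairs are only needed for i ≥ 1, where 2 * i ∸ 1 does not truncate.
reads-pairBlocks : ∀ ρ φ n → reads (map (pairBlock ρ φ) (interval 1 n)) ≡ map ρ (interval 1 (n + n))
reads-pairBlocks ρ φ n =
  reads-pairs (pairBlock ρ φ) (λ i → 2 * i ∸ 1) 1 n (λ { (suc i) _ → refl }) (λ { (suc i) _ → cong suc (+-suc i _) })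

module EvenProgram (h : ℕ) (ρ : ℕ → ℕ) (φ : ℕ → Prim)
                   (rule : ∀ j → 1 ≤ j → j ≤ h → PairRule (h ∸ j) (φ j)) (last : lastOK (φ h)) where

  blocks : List Block
  blocks = map (pairBlock ρ φ) (interval 1 h)

  program≡ : seqᵢ 1 h (code ∘ pairBlock ρ φ) ++ halt ∷ [] ≡ program blocks
  program≡ = cong (_++ halt ∷ []) (seqᵢ-blocks (pairBlock ρ φ) 1 h)

  wellFormed : WellFormed blocks
  wellFormed = subst WellFormed (++-identityʳ blocks) (wellFormed-map-++ (pairBlock ρ φ) tt 1 h safe)
    where
    safe : ∀ i n′ → 1 ≤ i → i + suc n′ ≡ suc h → SafeAction (φ i) (map (pairBlock ρ φ) (interval (suc i) n′) ++ [])
    safe i n′ 1≤i eq = pairRun-safe (pairBlock ρ φ) (λ _ → tt) eq (rule i 1≤i (m+[1+n]≡1+o⇒m≤o eq)) last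

even-computes : ∀ h X → CEven h X → Computes (h + h) tstnz X
even-computes h _ (ρ , φ , bij , rule , last , refl) =
  subst (Computes (h + h) tstnz) (sym program≡) (blockProgram-computes bij wellFormed (reads-pairBlocks ρ φ h))
  where open EvenProgram h ρ φ rule last

OddRule : ℕ → ℕ → ℕ → Prim → Set
OddRule h m j u =
  (∃ λ k → 1 ≤ k × k ≤ suc h ∸ j × (j ≤ m × m < j + k) × u ≡ jump (3 * k ∸ 1)) ⊎
  (∃ λ k → 1 ≤ k × k ≤ suc h ∸ j × ¬ (j ≤ m × m < j + k) × u ≡ jump (3 * k)) ⊎
  setOut1 u

module OddProgram (h m : ℕ) (ρ : ℕ → ℕ) (φ : ℕ → Prim) (m≤h : m ≤ h)
                  (rule : ∀ j → 1 ≤ j → j ≤ suc h → OddRule h m j (φ j)) (last : lastOK (φ (suc h))) where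

  t : ℕ
  t = h ∸ m

  m+t≡h : m + t ≡ h
  m+t≡h = m+[n∸m]≡n m≤h

  head : List Block
  head = map (pairBlock ρ φ) (interval 1 m)

  middle : Block
  middle = single (ρ (2 * m + 1)) (φ (m + 1))

  tail : List Block
  tail = map (shiftedPairBlock ρ φ) (interval (suc m) t)

  blocks : List Block
  blocks = head ++ middle ∷ tail

  program≡ : seqᵢ 1 m (code ∘ pairBlock ρ φ) ++ code middle ++
             seqᵢ (m + 1) h (code ∘ shiftedPairBlock ρ φ) ++ halt ∷ [] ≡ program blocks
  program≡ = begin
    seqᵢ 1 m (code ∘ pairBlock ρ φ) ++ code middle ++ seqᵢ (m + 1) h (code ∘ shiftedPairBlock ρ φ) ++ halt ∷ []
      ≡⟨ cong₂ (λ xs ys → xs ++ code middle ++ ys ++ halt ∷ []) (seqᵢ-blocks (pairBlock ρ φ) 1 m) tail≡ ⟩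
    concatMap code head ++ code middle ++ concatMap code tail ++ halt ∷ []
      ≡⟨ sym (++-assoc (concatMap code head) _ _) ⟩
    (concatMap code head ++ code middle ++ concatMap code tail) ++ halt ∷ []
      ≡⟨ cong (_++ halt ∷ []) (sym (concatMap-++ code head (middle ∷ tail))) ⟩
    program blocks ∎
    where
    open ≡-Reasoning
    tail≡ : seqᵢ (m + 1) h (code ∘ shiftedPairBlock ρ φ) ≡ concatMap code tail
    tail≡ = trans (seqᵢ-blocks (shiftedPairBlock ρ φ) (m + 1) h)
                  (cong (λ j → concatMap code (map (shiftedPairBlock ρ φ) (interval j (suc h ∸ j)))) (+-comm m 1))

  reads≡ : reads blocks ≡ map ρ (interval 1 (suc (h + h)))
  reads≡ = begin
    reads (head ++ middle ∷ tail)
      ≡⟨ concatMap-++ inputs head (middle ∷ tail) ⟩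
    reads head ++ ρ (2 * m + 1) ∷ reads tail
      ≡⟨ cong₂ (λ xs ys → xs ++ ρ (2 * m + 1) ∷ ys) (reads-pairBlocks ρ φ m) reads-tail ⟩
    map ρ (interval 1 (m + m)) ++ ρ (2 * m + 1) ∷ map ρ (interval (2 * suc m) (t + t))
      ≡⟨ cong₂ (λ i j → map ρ (interval 1 (m + m)) ++ ρ i ∷ map ρ (interval j (t + t))) (2m+1 m) (2[1+m] m) ⟩
    map ρ (interval 1 (m + m)) ++ map ρ (interval (1 + (m + m)) (suc (t + t)))
      ≡⟨ sym (map-++ ρ (interval 1 (m + m)) _) ⟩
    map ρ (interval 1 (m + m) ++ interval (1 + (m + m)) (suc (t + t)))
      ≡⟨ cong (map ρ) (sym (interval-++ 1 (m + m) (suc (t + t)))) ⟩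
    map ρ (interval 1 (m + m + suc (t + t)))
      ≡⟨ cong (λ n → map ρ (interval 1 n)) (trans (count m t) (cong (λ n → suc (n + n)) m+t≡h)) ⟩
    map ρ (interval 1 (suc (h + h))) ∎
    where
    open ≡-Reasoning
    2m+1 : ∀ m → 2 * m + 1 ≡ suc (m + m)
    2m+1 = solve-∀
    2[1+m] : ∀ m → 2 * suc m ≡ suc (suc (m + m))
    2[1+m] = solve-∀
    count : ∀ m t → m + m + suc (t + t) ≡ suc ((m + t) + (m + t))
    count = solve-∀
    reads-tail : reads tail ≡ map ρ (interval (2 * suc m) (t + t))
    reads-tail = reads-pairs (shiftedPairBlock ρ φ) (2 *_) (suc m) t
      (λ i _ → cong (λ k → ρ (2 * i) ∷ ρ k ∷ []) (+-comm (2 * i) 1)) (λ i _ → *-suc 2 i)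

  rule-beyond : ∀ j → m < j → j ≤ suc h → PairRule (suc h ∸ j) (φ j)
  rule-beyond j m<j j≤ with rule j (≤-trans (s≤s z≤n) m<j) j≤
  ... | inj₁ (_ , _ , _ , (j≤m , _) , _) = contradiction m<j (≤⇒≯ j≤m)
  ... | inj₂ (inj₁ (k , 1≤k , k≤ , _ , eq)) = inj₁ (k , 1≤k , k≤ , eq)
  ... | inj₂ (inj₂ s) = inj₂ s

  middle-safe : ∀ t → m + t ≡ h → SafeAction (φ (m + 1)) (map (shiftedPairBlock ρ φ) (interval (suc m) t))
  middle-safe zero    eq = lastOK-safe (subst (λ j → lastOK (φ j)) (sym m+1≡1+h) last)
    where
    m+1≡1+h : m + 1 ≡ suc h
    m+1≡1+h = trans (+-comm m 1) (cong suc (trans (sym (+-identityʳ m)) eq))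
  middle-safe (suc t) eq =
    pairRule-safe (All-pairs (shiftedPairBlock ρ φ) (λ _ → tt) (interval (suc m) (suc t)))
      (subst (λ r → PairRule r (φ (m + 1))) r≡
        (rule-beyond (m + 1) (m<m+n m (s≤s z≤n)) (≤-trans (≤-reflexive (+-comm m 1)) (s≤s m≤h))))
    where
    r≡ : suc h ∸ (m + 1) ≡ suc (length (map (shiftedPairBlock ρ φ) (interval (suc (suc m)) t)))
    r≡ = trans (cong (suc h ∸_) (+-comm m 1))
           (trans (cong (_∸ m) (sym eq)) (trans (m+n∸m≡n m (suc t)) (cong suc (sym (length-blocks _ _ t)))))

  head-safe : ∀ i n′ → 1 ≤ i → i + suc n′ ≡ suc m →
              SafeAction (φ i) (map (pairBlock ρ φ) (interval (suc i) n′) ++ middle ∷ tail)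
  head-safe i n′ 1≤i eq = by-rule (rule i 1≤i (≤-trans i≤m (≤-trans m≤h (n≤1+n h))))
    where
    later : List Block
    later = map (pairBlock ρ φ) (interval (suc i) n′)
    pairs : All IsPair later
    pairs = All-pairs (pairBlock ρ φ) (λ _ → tt) (interval (suc i) n′)
    i≤m : i ≤ m
    i≤m = m+[1+n]≡1+o⇒m≤o eq
    i+n′≡m : i + n′ ≡ m
    i+n′≡m = suc-injective (trans (sym (+-suc i n′)) eq)
    |later|≡n′ : length later ≡ n′
    |later|≡n′ = length-blocks (pairBlock ρ φ) (suc i) n′

    by-rule : OddRule h m i (φ i) → SafeAction (φ i) (later ++ middle ∷ tail)
    by-rule (inj₁ (k , _ , k≤1+h∸i , (_ , m<i+k) , φi≡)) =
      subst (λ u → SafeAction u (later ++ middle ∷ tail)) (sym φi≡)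
        (jump-across-safe pairs (All-pairs (shiftedPairBlock ρ φ) (λ _ → tt) (interval (suc m) t)) n′<k k≤room)
      where
      n′<k : length later < k
      n′<k = subst (_< k) (sym |later|≡n′) (+-cancelˡ-< i n′ k (subst (_< i + k) (sym i+n′≡m) m<i+k))
      k≤room : k ≤ length later + suc (length tail)
      k≤room = ≤-trans k≤1+h∸i (≤-reflexive (begin
        suc h ∸ i                        ≡⟨ cong (λ n → suc n ∸ i) (sym (trans (cong (_+ t) i+n′≡m) m+t≡h)) ⟩
        suc (i + n′ + t) ∸ i             ≡⟨ [1+m+n+o]∸m≡n+[1+o] i n′ t ⟩
        n′ + suc t                       ≡⟨ cong₂ (λ a b → a + suc b) (sym |later|≡n′) (sym (length-blocks _ _ t)) ⟩
        length later + suc (length tail) ∎))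
        where open ≡-Reasoning
    by-rule (inj₂ (inj₁ (k , 1≤k , _ , ¬crossing , φi≡))) =
      subst (λ u → SafeAction u (later ++ middle ∷ tail)) (sym φi≡)
        (SafeAction-++ʳ (middle ∷ tail) (jump3-safe pairs 1≤k (subst (k ≤_) (sym |later|≡n′) k≤n′)))
      where
      k≤n′ : k ≤ n′
      k≤n′ = +-cancelˡ-≤ i k n′ (subst (i + k ≤_) (sym i+n′≡m) (≮⇒≥ (λ m<i+k → ¬crossing (i≤m , m<i+k))))
    by-rule (inj₂ (inj₂ s)) = setOut1-safe later s

  tail-safe : ∀ i n′ → suc m ≤ i → i + suc n′ ≡ suc m + t →
              SafeAction (φ (i + 1)) (map (shiftedPairBlock ρ φ) (interval (suc i) n′) ++ [])
  tail-safe i n′ m<i eq = pairRun-safe (shiftedPairBlock ρ φ) (λ _ → tt) eq′ rule′ last′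
    where
    eq′ : i + suc n′ ≡ suc h
    eq′ = trans eq (cong suc m+t≡h)
    rule′ : PairRule (h ∸ i) (φ (i + 1))
    rule′ = subst (λ r → PairRule r (φ (i + 1))) (cong (suc h ∸_) (+-comm i 1))
              (rule-beyond (i + 1) (≤-trans m<i (m≤m+n i 1))
                (≤-trans (≤-reflexive (+-comm i 1)) (s≤s (m+[1+n]≡1+o⇒m≤o eq′))))
    last′ : lastOK (φ (h + 1))
    last′ = subst (λ j → lastOK (φ j)) (+-comm 1 h) last

  wellFormed : WellFormed blocks
  wellFormed = wellFormed-map-++ (pairBlock ρ φ) (middle-safe t m+t≡h , tail-wellFormed) 1 m head-safe
    where
    tail-wellFormed : WellFormed tail
    tail-wellFormed =
      subst WellFormed (++-identityʳ tail) (wellFormed-map-++ (shiftedPairBlock ρ φ) tt (suc m) t tail-safe)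

odd-computes : ∀ h X → COdd h X → Computes (suc (h + h)) tstnz X
odd-computes h _ (m , ρ , φ , m≤h , bij , rule , last , refl) =
  subst (Computes (suc (h + h)) tstnz) (sym program≡) (blockProgram-computes bij wellFormed reads≡)
  where open OddProgram h m ρ φ m≤h rule last

even⇒≡⌊n/2⌋+⌊n/2⌋ : ∀ n → n % 2 ≡ 0 → n ≡ ⌊ n /2⌋ + ⌊ n /2⌋
even⇒≡⌊n/2⌋+⌊n/2⌋ zero          _ = refl
even⇒≡⌊n/2⌋+⌊n/2⌋ (suc zero)    ()
even⇒≡⌊n/2⌋+⌊n/2⌋ (suc (suc n)) e =
  cong suc (trans (cong suc (even⇒≡⌊n/2⌋+⌊n/2⌋ n e)) (sym (+-suc ⌊ n /2⌋ ⌊ n /2⌋)))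

odd⇒≡1+⌊n/2⌋+⌊n/2⌋ : ∀ n → n % 2 ≡ 1 → n ≡ suc (⌊ n /2⌋ + ⌊ n /2⌋)
odd⇒≡1+⌊n/2⌋+⌊n/2⌋ zero          ()
odd⇒≡1+⌊n/2⌋+⌊n/2⌋ (suc zero)    _ = refl
odd⇒≡1+⌊n/2⌋+⌊n/2⌋ (suc (suc n)) e =
  cong suc (trans (cong suc (odd⇒≡1+⌊n/2⌋+⌊n/2⌋ n e)) (cong suc (sym (+-suc ⌊ n /2⌋ ⌊ n /2⌋))))

theorem2 : ∀ (n : ℕ) → 1 ≤ n → ∀ (X : IS) → C n X → Computes n tstnz X
theorem2 n _ X (inj₁ (n%2≡0 , X∈C)) =
  subst (λ k → Computes k tstnz X) (sym (even⇒≡⌊n/2⌋+⌊n/2⌋ n n%2≡0)) (even-computes ⌊ n /2⌋ X X∈C)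
theorem2 n _ X (inj₂ (n%2≡1 , X∈C)) =
  subst (λ k → Computes k tstnz X) (sym (odd⇒≡1+⌊n/2⌋+⌊n/2⌋ n n%2≡1)) (odd-computes ⌊ n /2⌋ X X∈C)
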